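{- Let $(a,b,c)$ be a good triple of positive integers with $b\leq c$, and let $n=a+b+c$. If $n$ is even, then $a=n/2$ or $a=n/2-1$. If $n$ is odd, then $a=(n-1)/2$.
   Context: For positive integers $a,b,c$ with $n=a+b+c$, the permutation of the triple $(a,b,c)$ is the permutation of $[n]$ with $p_i=n+1-i$ for $1\le i\le a$, $p_i=a+b+1-i$ for $a+1\le i\le a+b$, and $p_i=n+b+1-i$ for $a+b+1\le i\le n$ (one-line notation $n\cdots(n-a+1)\ b\cdots1\ (b+c)\cdots(b+1)$). The triple is good if this permutation, as a bijection $i\mapsto p_i$ of $[n]$, is a single $n$-cycle. -}

module Defs where

open import Data.Nat using (ℕ; zero; suc; _+_; _∸_; _≤_; _≤ᵇ_)
open import Data.Bool using (if_then_else_)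
open import Data.Product using (∃-syntax; _×_)
open import Relation.Binary.PropositionalEquality using (_≡_)

-- The permutation of the triple (a,b,c) as a function on ℕ (meaningful on [n] = {1..n}):
--   p i = n+1-i       for 1 ≤ i ≤ a
--   p i = a+b+1-i     for a+1 ≤ i ≤ a+b
--   p i = n+b+1-i     for a+b+1 ≤ i ≤ n
tripPerm : ℕ → ℕ → ℕ → ℕ → ℕ
tripPerm a b c i =
  if i ≤ᵇ a then (a + b + c + 1) ∸ i
  else if i ≤ᵇ a + b then (a + b + 1) ∸ i
  else (a + b + c + b + 1) ∸ i

iter : (ℕ → ℕ) → ℕ → ℕ → ℕ
iter f zero x = x
iter f (suc k) x = f (iter f k x)

-- The permutation (a bijection of [n]) is a single n-cycle: the cyclic group it
-- generates acts transitively on [n], i.e. every j ∈ [n] lies in the orbit of every i ∈ [n].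
IsSingleCycle : ℕ → (ℕ → ℕ) → Set
IsSingleCycle n p = ∀ i j → 1 ≤ i → i ≤ n → 1 ≤ j → j ≤ n → ∃[ k ] iter p k i ≡ j

Good : ℕ → ℕ → ℕ → Set
Good a b c = IsSingleCycle (a + b + c) (tripPerm a b c)

module Submission where

-- Write p for the permutation of the triple (a,b,c), n = a+b+c and m = b+c.  The
-- theorem says that a good triple has m ∈ {a, a+1, a+2}, i.e. n ∈ {2a, 2a+1, 2a+2};
-- the statement about n/2 is then a parity computation.
--
--  * If m < a, then p swaps a and m+1, so the orbit of a misses 1.
--  * If a ≤ m, let J swap the blocks [1,a] and [m+1,m+a] by translation by m and fix
--    (a,m].  Block by block one checks p (J (p i)) = J i on [1,n], i.e. J conjugates
--    p to its inverse, hence pᵏ (J (pᵏ i)) = J i.  So if x and pᵏ x are J-fixed then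
--    p²ᵏ x = x, and a Euclidean descent shows that an orbit contains at most two
--    J-fixed points.  If m ≥ a+3 the J-fixed points a+1, a+2, a+3 would all lie on
--    the single orbit of p, a contradiction.

open import Defs
open import Data.Nat using (ℕ; zero; suc; _+_; _*_; _≤_; _<_; _%_; _/_; _∸_; _≤ᵇ_; z≤n; s≤s)
open import Data.Nat.Properties
open import Data.Nat.DivMod using ([m+kn]%n≡m%n; m*n%n≡0; m*n/n≡m)
open import Data.Nat.Induction using (<-wellFounded)
open import Data.Nat.Tactic.RingSolver using (solve)
open import Data.Bool using (true; false; T; if_then_else_)
open import Data.List using ([]; _∷_)
open import Data.Sum using (_⊎_; inj₁; inj₂)
open import Data.Product using (_×_; _,_; ∃-syntax; proj₁; proj₂)
open import Data.Empty using (⊥; ⊥-elim)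
open import Function using (_∘_)
open import Induction.WellFounded using (Acc; acc)
open import Relation.Nullary using (¬_)
open import Relation.Binary.PropositionalEquality
  using (_≡_; refl; sym; trans; cong; subst; subst₂; module ≡-Reasoning)
open ≡-Reasoning

iter-+ : ∀ (f : ℕ → ℕ) j k x → iter f (j + k) x ≡ iter f j (iter f k x)
iter-+ f zero    k x = refl
iter-+ f (suc j) k x = cong f (iter-+ f j k x)

iter-suc-inner : ∀ (f : ℕ → ℕ) k x → iter f (suc k) x ≡ iter f k (f x)
iter-suc-inner f k x = trans (cong (λ j → iter f j x) (+-comm 1 k)) (iter-+ f k 1 x)

HalfReturn : (ℕ → ℕ) → ℕ → ℕ → Set
HalfReturn f x k = iter f (k + k) x ≡ x

-- The proof
-- is Euclid's algorithm on (k, l), since half-return times are closed under differences.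
module ReflectionPoints (f : ℕ → ℕ) (x : ℕ) where

  Coincide : ℕ → ℕ → Set
  Coincide k l = iter f k x ≡ iter f l x ⊎ iter f k x ≡ x ⊎ iter f l x ≡ x

  coincide-sym : ∀ k l → Coincide k l → Coincide l k
  coincide-sym _ _ (inj₁ eq)        = inj₁ (sym eq)
  coincide-sym _ _ (inj₂ (inj₁ eq)) = inj₂ (inj₂ eq)
  coincide-sym _ _ (inj₂ (inj₂ eq)) = inj₂ (inj₁ eq)

  halfReturn-difference : ∀ k o → HalfReturn f x k → HalfReturn f x (k + o) → HalfReturn f x o
  halfReturn-difference k o hk hko = begin
    iter f (o + o) x                    ≡⟨ cong (iter f (o + o)) hk ⟨
    iter f (o + o) (iter f (k + k) x)   ≡⟨ iter-+ f (o + o) (k + k) x ⟨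
    iter f ((o + o) + (k + k)) x        ≡⟨ cong (λ j → iter f j x) reorder ⟩
    iter f ((k + o) + (k + o)) x        ≡⟨ hko ⟩
    x                                   ∎
    where
    reorder : (o + o) + (k + k) ≡ (k + o) + (k + o)
    reorder = solve (k ∷ o ∷ [])

  coincide-extend : ∀ k o → HalfReturn f x k → Coincide k o → Coincide k (k + o)
  coincide-extend k o hk (inj₁ eq) = inj₂ (inj₂ (begin
    iter f (k + o) x           ≡⟨ iter-+ f k o x ⟩
    iter f k (iter f o x)      ≡⟨ cong (iter f k) eq ⟨
    iter f k (iter f k x)      ≡⟨ iter-+ f k k x ⟨
    iter f (k + k) x           ≡⟨ hk ⟩
    x                          ∎))
  coincide-extend k o hk (inj₂ (inj₁ eq)) = inj₂ (inj₁ eq)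
  coincide-extend k o hk (inj₂ (inj₂ eq)) =
    inj₁ (sym (trans (iter-+ f k o x) (cong (iter f k) eq)))

  coincide-acc : ∀ k l → Acc _<_ (k + l) → HalfReturn f x k → HalfReturn f x l → Coincide k l
  coincide-acc zero    l       _         _  _  = inj₂ (inj₁ refl)
  coincide-acc (suc k) zero    _         _  _  = inj₂ (inj₂ refl)
  coincide-acc (suc k) (suc l) (acc rec) hk hl with ≤-total (suc k) (suc l)
  ... | inj₁ k≤l with o , refl ← m≤n⇒∃[o]m+o≡n k≤l =
    coincide-extend (suc k) o hk
      (coincide-acc (suc k) o (rec (+-monoʳ-< (suc k) (s≤s (m≤n+m o k))))
        hk (halfReturn-difference (suc k) o hk hl))
  ... | inj₂ l≤k with o , refl ← m≤n⇒∃[o]m+o≡n l≤k =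
    coincide-sym (suc l) (suc (l + o)) (coincide-extend (suc l) o hl
      (coincide-acc (suc l) o (rec (m<m+n (suc (l + o)) (s≤s z≤n)))
        hl (halfReturn-difference (suc l) o hl hk)))

  coincide : ∀ k l → HalfReturn f x k → HalfReturn f x l → Coincide k l
  coincide k l = coincide-acc k l (<-wellFounded (k + l))

-- A map J reverses f on an f-invariant domain when f ∘ J ∘ f = J there (for a
-- permutation f: J conjugates f to f⁻¹).  Then fᵏ ∘ J ∘ fᵏ = J, so a step between two
-- J-fixed points is a half-return time, and an orbit carries at most two J-fixed points.
module Reversal (f J : ℕ → ℕ) (Dom : ℕ → Set)
                (f-Dom : ∀ {i} → Dom i → Dom (f i))
                (reverses : ∀ {i} → Dom i → f (J (f i)) ≡ J i) where

  iter-Dom : ∀ k {i} → Dom i → Dom (iter f k i)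
  iter-Dom zero    di = di
  iter-Dom (suc k) di = f-Dom (iter-Dom k di)

  iter-reverses : ∀ k {i} → Dom i → iter f k (J (iter f k i)) ≡ J i
  iter-reverses zero    di = refl
  iter-reverses (suc k) {i} di = begin
    iter f (suc k) (J (f (iter f k i)))   ≡⟨ iter-suc-inner f k _ ⟩
    iter f k (f (J (f (iter f k i))))     ≡⟨ cong (iter f k) (reverses (iter-Dom k di)) ⟩
    iter f k (J (iter f k i))             ≡⟨ iter-reverses k di ⟩
    J i                                   ∎

  halfReturn-between-fixed : ∀ {x y} k → Dom x → J x ≡ x → J y ≡ y → iter f k x ≡ y →
                             HalfReturn f x k
  halfReturn-between-fixed {x} {y} k dx Jx Jy fᵏx≡y = begin
    iter f (k + k) x              ≡⟨ iter-+ f k k x ⟩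
    iter f k (iter f k x)         ≡⟨ cong (iter f k) fᵏx≡y ⟩
    iter f k y                    ≡⟨ cong (iter f k) Jy ⟨
    iter f k (J y)                ≡⟨ cong (iter f k ∘ J) fᵏx≡y ⟨
    iter f k (J (iter f k x))     ≡⟨ iter-reverses k dx ⟩
    J x                           ≡⟨ Jx ⟩
    x                             ∎

  fixed-points-coincide : ∀ {x y z} k l → Dom x → J x ≡ x → J y ≡ y → J z ≡ z →
                          iter f k x ≡ y → iter f l x ≡ z → y ≡ z ⊎ y ≡ x ⊎ z ≡ x
  fixed-points-coincide {x} {y} {z} k l dx Jx Jy Jz fᵏx≡y fˡx≡z
    with ReflectionPoints.coincide f x k l (halfReturn-between-fixed k dx Jx Jy fᵏx≡y)
                                           (halfReturn-between-fixed l dx Jx Jz fˡx≡z)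
  ... | inj₁ eq        = inj₁ (trans (sym fᵏx≡y) (trans eq fˡx≡z))
  ... | inj₂ (inj₁ eq) = inj₂ (inj₁ (trans (sym fᵏx≡y) eq))
  ... | inj₂ (inj₂ eq) = inj₂ (inj₂ (trans (sym fˡx≡z) eq))

two-cycle : ∀ (f : ℕ → ℕ) {x y} → f x ≡ y → f y ≡ x → ∀ k → iter f k x ≡ x ⊎ iter f k x ≡ y
two-cycle f fx fy zero = inj₁ refl
two-cycle f fx fy (suc k) with two-cycle f fx fy k
... | inj₁ eq = inj₂ (trans (cong f eq) fx)
... | inj₂ eq = inj₁ (trans (cong f eq) fy)

-- A comparison view: matching on it rewrites the larger number as the smaller one plus
-- an offset, so that every region of the case analysis below is described by variables.
data Order : ℕ → ℕ → Set where
  below : ∀ x d → Order x (x + d)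
  above : ∀ y e → Order (suc (y + e)) y

order : ∀ x y → Order x y
order zero    y       = below 0 y
order (suc x) zero    = above 0 x
order (suc x) (suc y) with order x y
... | below x d = below (suc x) d
... | above y e = above (suc y) e

if-yes : ∀ {A : Set} {x y} (u v : A) → x ≤ y → (if x ≤ᵇ y then u else v) ≡ u
if-yes {x = x} {y} u v x≤y with x ≤ᵇ y | ≤⇒≤ᵇ x≤y
... | true | _ = refl

if-no : ∀ {A : Set} {x y} (u v : A) → y < x → (if x ≤ᵇ y then u else v) ≡ v
if-no {x = x} {y} u v y<x with x ≤ᵇ y in eq
... | false = refl
... | true  = ⊥-elim (<⇒≱ y<x (≤ᵇ⇒≤ x y (subst T (sym eq) _)))

∸-by : ∀ {x y s} → x + y ≡ s → s ∸ x ≡ y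
∸-by {x} {y} refl = m+n∸m≡n x y

≤-by : ∀ {x y} d → x + d ≡ y → x ≤ y
≤-by {x} d refl = m≤m+n x d

-- The reversing map J for p: blocks [1,a] and [m+1,m+a] are exchanged by translation
-- by m, and (a,m] is fixed (a ≤ m is assumed wherever it matters).
blockSwap : ℕ → ℕ → ℕ → ℕ
blockSwap a m i = if i ≤ᵇ m then (if i ≤ᵇ a then m + i else i) else i ∸ m

module Evaluation (a b c : ℕ) where

  p J : ℕ → ℕ
  p = tripPerm a b c
  J = blockSwap a (b + c)

  p-first : ∀ x y → x ≤ a → x + y ≡ a + b + c + 1 → p x ≡ y
  p-first x y x≤a eq = trans (if-yes _ _ x≤a) (∸-by eq)

  p-second : ∀ x y → a < x → x ≤ a + b → x + y ≡ a + b + 1 → p x ≡ y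
  p-second x y a<x x≤a+b eq = trans (if-no _ _ a<x) (trans (if-yes _ _ x≤a+b) (∸-by eq))

  p-third : ∀ x y → a + b < x → x + y ≡ a + b + c + b + 1 → p x ≡ y
  p-third x y a+b<x eq =
    trans (if-no _ _ (≤-<-trans (m≤m+n a b) a+b<x)) (trans (if-no _ _ a+b<x) (∸-by eq))

  J-first : ∀ x → x ≤ a → a ≤ b + c → J x ≡ b + c + x
  J-first x x≤a a≤m = trans (if-yes _ _ (≤-trans x≤a a≤m)) (if-yes _ _ x≤a)

  J-middle : ∀ x → a < x → x ≤ b + c → J x ≡ x
  J-middle x a<x x≤m = trans (if-yes _ _ x≤m) (if-no _ _ a<x)

  J-last : ∀ x y → b + c + suc y ≡ x → J x ≡ suc y
  J-last x y refl = trans (if-no _ _ (m<m+n (b + c) (s≤s z≤n))) (m+n∸m≡n (b + c) (suc y))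

  Reverses : ℕ → Set
  Reverses i = p (J (p i)) ≡ J i

-- i ≤ a, written i = 1+i₀, a = i+d:  i ↦ m+1+d ↦ 1+d ↦ m+i = J i.
reverses-block₁ : ∀ i₀ d b c → suc i₀ + d ≤ b + c →
    Evaluation.Reverses (suc i₀ + d) b c (suc i₀)
reverses-block₁ i₀ d b c a≤m = begin
  p (J (p (suc i₀)))
    ≡⟨ cong (p ∘ J) (p-first (suc i₀) (b + c + suc d) (m≤m+n (suc i₀) d)
         (solve (i₀ ∷ d ∷ b ∷ c ∷ []))) ⟩
  p (J (b + c + suc d))
    ≡⟨ cong p (J-last (b + c + suc d) d refl) ⟩
  p (suc d)
    ≡⟨ p-first (suc d) (b + c + suc i₀) (≤-by i₀ (solve (i₀ ∷ d ∷ [])))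
         (solve (i₀ ∷ d ∷ b ∷ c ∷ [])) ⟩
  b + c + suc i₀
    ≡⟨ J-first (suc i₀) (m≤m+n (suc i₀) d) a≤m ⟨
  J (suc i₀)
    ∎
  where open Evaluation (suc i₀ + d) b c

-- a < i ≤ b, written i = a+1+e, b = 1+e+a+h:  i ↦ a+1+h (fixed by J) ↦ i = J i.
reverses-block₂-low : ∀ a e h c → Evaluation.Reverses a (suc e + (a + h)) c (suc (a + e))
reverses-block₂-low a e h c = begin
  p (J (p (suc (a + e))))
    ≡⟨ cong (p ∘ J) (p-second (suc (a + e)) (suc (a + h)) (s≤s (m≤m+n a e))
         (≤-by (a + h) (solve (a ∷ e ∷ h ∷ []))) (solve (a ∷ e ∷ h ∷ []))) ⟩
  p (J (suc (a + h)))
    ≡⟨ cong p (J-middle (suc (a + h)) (s≤s (m≤m+n a h))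
         (≤-by (e + c) (solve (a ∷ e ∷ h ∷ c ∷ [])))) ⟩
  p (suc (a + h))
    ≡⟨ p-second (suc (a + h)) (suc (a + e)) (s≤s (m≤m+n a h))
         (≤-by (a + e) (solve (a ∷ e ∷ h ∷ []))) (solve (a ∷ e ∷ h ∷ [])) ⟩
  suc (a + e)
    ≡⟨ J-middle (suc (a + e)) (s≤s (m≤m+n a e)) (≤-by (h + c) (solve (a ∷ e ∷ h ∷ c ∷ []))) ⟨
  J (suc (a + e))
    ∎
  where open Evaluation a (suc e + (a + h)) c

-- b < i ≤ a+b, i ≤ m, written a = 1+f+h, b = 1+e+f, c = 1+h+k, i = a+1+e:
-- i ↦ 1+f ↦ m+1+f (third block) ↦ i = J i.
reverses-block₂-mid : ∀ e f h k → suc (f + h) ≤ suc e + f + (suc h + k) →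
    Evaluation.Reverses (suc (f + h)) (suc e + f) (suc h + k) (suc (suc (f + h) + e))
reverses-block₂-mid e f h k a≤m = begin
  p (J (p (suc (suc (f + h) + e))))
    ≡⟨ cong (p ∘ J) (p-second (suc (suc (f + h) + e)) (suc f) (s≤s (m≤m+n (suc (f + h)) e))
         (≤-by f (solve (e ∷ f ∷ h ∷ []))) (solve (e ∷ f ∷ h ∷ []))) ⟩
  p (J (suc f))
    ≡⟨ cong p (J-first (suc f) (s≤s (m≤m+n f h)) a≤m) ⟩
  p (suc e + f + (suc h + k) + suc f)
    ≡⟨ p-third (suc e + f + (suc h + k) + suc f) (suc (suc (f + h) + e))
         (≤-by k (solve (e ∷ f ∷ h ∷ k ∷ []))) (solve (e ∷ f ∷ h ∷ k ∷ [])) ⟩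
  suc (suc (f + h) + e)
    ≡⟨ J-middle (suc (suc (f + h) + e)) (s≤s (m≤m+n (suc (f + h)) e))
         (≤-by k (solve (e ∷ f ∷ h ∷ k ∷ []))) ⟨
  J (suc (suc (f + h) + e))
    ∎
  where open Evaluation (suc (f + h)) (suc e + f) (suc h + k)

-- m < i ≤ a+b, written a = 1+f+c+k, b = 1+e+f, i = a+1+e:
-- i ↦ 1+f ↦ m+1+f (second block) ↦ 1+k = i-m = J i.
reverses-block₂-high : ∀ e f c k → suc (f + (c + k)) ≤ suc e + f + c →
    Evaluation.Reverses (suc (f + (c + k))) (suc e + f) c (suc (suc (f + (c + k)) + e))
reverses-block₂-high e f c k a≤m = begin
  p (J (p (suc (suc (f + (c + k)) + e))))
    ≡⟨ cong (p ∘ J) (p-second (suc (suc (f + (c + k)) + e)) (suc f)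
         (s≤s (m≤m+n (suc (f + (c + k))) e))
         (≤-by f (solve (e ∷ f ∷ c ∷ k ∷ []))) (solve (e ∷ f ∷ c ∷ k ∷ []))) ⟩
  p (J (suc f))
    ≡⟨ cong p (J-first (suc f) (s≤s (m≤m+n f (c + k))) a≤m) ⟩
  p (suc e + f + c + suc f)
    ≡⟨ p-second (suc e + f + c + suc f) (suc k) (≤-<-trans a≤m (m<m+n (suc e + f + c) (s≤s z≤n)))
         (≤-by k (solve (e ∷ f ∷ c ∷ k ∷ []))) (solve (e ∷ f ∷ c ∷ k ∷ [])) ⟩
  suc k
    ≡⟨ J-last (suc (suc (f + (c + k)) + e)) k (solve (e ∷ f ∷ c ∷ k ∷ [])) ⟨
  J (suc (suc (f + (c + k)) + e))
    ∎
  where open Evaluation (suc (f + (c + k))) (suc e + f) c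

-- a+b < i ≤ m, written c = 1+g+a+h, i = a+b+1+g:  i ↦ b+1+a+h (fixed by J) ↦ i = J i.
reverses-block₃-low : ∀ a b g h → Evaluation.Reverses a b (suc g + (a + h)) (suc (a + (b + g)))
reverses-block₃-low a b g h = begin
  p (J (p (suc (a + (b + g)))))
    ≡⟨ cong (p ∘ J) (p-third (suc (a + (b + g))) (b + suc (a + h))
         (≤-by g (solve (a ∷ b ∷ g ∷ []))) (solve (a ∷ b ∷ g ∷ h ∷ []))) ⟩
  p (J (b + suc (a + h)))
    ≡⟨ cong p (J-middle (b + suc (a + h)) (≤-by (b + h) (solve (a ∷ b ∷ h ∷ [])))
         (≤-by g (solve (a ∷ b ∷ g ∷ h ∷ [])))) ⟩
  p (b + suc (a + h))
    ≡⟨ p-third (b + suc (a + h)) (suc (a + (b + g)))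
         (≤-by h (solve (a ∷ b ∷ h ∷ []))) (solve (a ∷ b ∷ g ∷ h ∷ [])) ⟩
  suc (a + (b + g))
    ≡⟨ J-middle (suc (a + (b + g))) (s≤s (m≤m+n a (b + g)))
         (≤-by h (solve (a ∷ b ∷ g ∷ h ∷ []))) ⟨
  J (suc (a + (b + g)))
    ∎
  where open Evaluation a b (suc g + (a + h))

-- m < i ≤ m+b, written a = 1+k+h, b = 1+h+l, c = 1+g+k, i = a+b+1+g:
-- i ↦ 1+k+b (fixed by J, second block) ↦ 1+h = i-m = J i.
reverses-block₃-mid : ∀ k h l g →
    Evaluation.Reverses (suc (k + h)) (suc h + l) (suc g + k) (suc (suc (k + h) + (suc h + l + g)))
reverses-block₃-mid k h l g = begin
  p (J (p (suc (suc (k + h) + (suc h + l + g)))))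
    ≡⟨ cong (p ∘ J) (p-third (suc (suc (k + h) + (suc h + l + g))) (suc (k + (suc h + l)))
         (≤-by g (solve (k ∷ h ∷ l ∷ g ∷ []))) (solve (k ∷ h ∷ l ∷ g ∷ []))) ⟩
  p (J (suc (k + (suc h + l))))
    ≡⟨ cong p (J-middle (suc (k + (suc h + l))) (≤-by l (solve (k ∷ h ∷ l ∷ [])))
         (≤-by g (solve (k ∷ h ∷ l ∷ g ∷ [])))) ⟩
  p (suc (k + (suc h + l)))
    ≡⟨ p-second (suc (k + (suc h + l))) (suc h) (≤-by l (solve (k ∷ h ∷ l ∷ [])))
         (≤-by h (solve (k ∷ h ∷ l ∷ []))) (solve (k ∷ h ∷ l ∷ [])) ⟩
  suc h
    ≡⟨ J-last (suc (suc (k + h) + (suc h + l + g))) h (solve (k ∷ h ∷ l ∷ g ∷ [])) ⟨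
  J (suc (suc (k + h) + (suc h + l + g)))
    ∎
  where open Evaluation (suc (k + h)) (suc h + l) (suc g + k)

-- m+b < i, written a = 1+k+b+l, c = 1+g+k, i = a+b+1+g:
-- i ↦ 1+k+b ↦ m+1+k+b (third block) ↦ 1+b+l = i-m = J i.
reverses-block₃-high : ∀ k b l g → suc (k + (b + l)) ≤ b + (suc g + k) →
    Evaluation.Reverses (suc (k + (b + l))) b (suc g + k) (suc (suc (k + (b + l)) + (b + g)))
reverses-block₃-high k b l g a≤m = begin
  p (J (p (suc (suc (k + (b + l)) + (b + g)))))
    ≡⟨ cong (p ∘ J) (p-third (suc (suc (k + (b + l)) + (b + g))) (suc (k + b))
         (≤-by g (solve (k ∷ b ∷ l ∷ g ∷ []))) (solve (k ∷ b ∷ l ∷ g ∷ []))) ⟩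
  p (J (suc (k + b)))
    ≡⟨ cong p (J-first (suc (k + b)) (≤-by l (solve (k ∷ b ∷ l ∷ []))) a≤m) ⟩
  p (b + (suc g + k) + suc (k + b))
    ≡⟨ p-third (b + (suc g + k) + suc (k + b)) (suc (b + l)) (+-mono-≤-< a≤m (s≤s (m≤n+m b k)))
         (solve (k ∷ b ∷ l ∷ g ∷ [])) ⟩
  suc (b + l)
    ≡⟨ J-last (suc (suc (k + (b + l)) + (b + g))) (b + l) (solve (k ∷ b ∷ l ∷ g ∷ [])) ⟨
  J (suc (suc (k + (b + l)) + (b + g)))
    ∎
  where open Evaluation (suc (k + (b + l))) b (suc g + k)

beyond-range : ∀ a b c k → suc (a + (b + (c + k))) ≤ a + b + c → ⊥
beyond-range a b c k i≤n = m+1+n≰m (a + b + c) (subst (_≤ a + b + c) overflow i≤n)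
  where
  overflow : suc (a + (b + (c + k))) ≡ a + b + c + suc k
  overflow = solve (a ∷ b ∷ c ∷ k ∷ [])

reverses : ∀ a b c i → 1 ≤ i → i ≤ a + b + c → a ≤ b + c → Evaluation.Reverses a b c i
reverses a b c (suc i₀) (s≤s z≤n) i≤n a≤m with order (suc i₀) a
... | below _ d = reverses-block₁ i₀ d b c a≤m
... | above _ e with order (suc e) b
...   | below _ f with order a f
...     | below _ h = reverses-block₂-low a e h c
...     | above _ h with order (suc h) c
...       | below _ k = reverses-block₂-mid e f h k a≤m
...       | above _ k = reverses-block₂-high e f c k a≤m
reverses a b c (suc i₀) (s≤s z≤n) i≤n a≤m | above _ e | above _ g with order (suc g) c
... | above _ k = ⊥-elim (beyond-range a b c k i≤n)
... | below _ k with order a k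
...   | below _ h = reverses-block₃-low a b g h
...   | above _ h with order (suc h) b
...     | below _ l = reverses-block₃-mid k h l g
...     | above _ l = reverses-block₃-high k b l g a≤m

InRange : ℕ → ℕ → Set
InRange n i = 1 ≤ i × i ≤ n

perm-range : ∀ a b c i → 1 ≤ i → i ≤ a + b + c → InRange (a + b + c) (tripPerm a b c i)
perm-range a b c (suc i₀) (s≤s z≤n) i≤n with order (suc i₀) a
... | below _ d = subst (InRange (suc i₀ + d + b + c))
        (sym (p-first (suc i₀) (b + c + suc d) (m≤m+n (suc i₀) d) (solve (i₀ ∷ d ∷ b ∷ c ∷ []))))
        (≤-by (b + c + d) (solve (d ∷ b ∷ c ∷ [])) , ≤-by i₀ (solve (i₀ ∷ d ∷ b ∷ c ∷ [])))
  where open Evaluation (suc i₀ + d) b c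
... | above _ e with order (suc e) b
...   | below _ f = subst (InRange (a + (suc e + f) + c))
          (sym (p-second (suc (a + e)) (suc f) (s≤s (m≤m+n a e))
                 (≤-by f (solve (a ∷ e ∷ f ∷ []))) (solve (a ∷ e ∷ f ∷ []))))
          (s≤s z≤n , ≤-by (a + e + c) (solve (a ∷ e ∷ f ∷ c ∷ [])))
  where open Evaluation a (suc e + f) c
...   | above _ g with order (suc g) c
...     | above _ k = ⊥-elim (beyond-range a b c k i≤n)
...     | below _ k = subst (InRange (a + b + (suc g + k)))
            (sym (p-third (suc (a + (b + g))) (b + suc k)
                   (≤-by g (solve (a ∷ b ∷ g ∷ []))) (solve (a ∷ b ∷ g ∷ k ∷ []))))
            (≤-by (b + k) (solve (b ∷ k ∷ [])) , ≤-by (a + g) (solve (a ∷ b ∷ g ∷ k ∷ [])))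
  where open Evaluation a b (suc g + k)

a≤a+b+c : ∀ a b c → a ≤ a + b + c
a≤a+b+c a b c = ≤-trans (m≤m+n a b) (m≤m+n (a + b) c)

b+c≤a+b+c : ∀ a b c → b + c ≤ a + b + c
b+c≤a+b+c a b c = subst (b + c ≤_) (sym (+-assoc a b c)) (m≤n+m (b + c) a)

-- If m < a then p swaps a and m+1, so 1 is not in the orbit of a.
large-a-not-good : ∀ a b c → 0 < b → b + c < a → ¬ Good a b c
large-a-not-good a b c 0<b m<a good = misses-1 (cycle (proj₁ reach)) (proj₂ reach)
  where
  open Evaluation a b c
  1≤a : 1 ≤ a
  1≤a = ≤-trans (s≤s z≤n) m<a
  reach : ∃[ k ] iter p k a ≡ 1
  reach = good a 1 1≤a (a≤a+b+c a b c) (s≤s z≤n) (≤-trans 1≤a (a≤a+b+c a b c))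
  cycle : ∀ k → iter p k a ≡ a ⊎ iter p k a ≡ suc (b + c)
  cycle = two-cycle p (p-first a (suc (b + c)) ≤-refl (solve (a ∷ b ∷ c ∷ [])))
                      (p-first (suc (b + c)) a m<a (solve (a ∷ b ∷ c ∷ [])))
  0<m : 0 < b + c
  0<m = ≤-trans 0<b (m≤m+n b c)
  misses-1 : ∀ {w} → w ≡ a ⊎ w ≡ suc (b + c) → w ≡ 1 → ⊥
  misses-1 (inj₁ w≡a) w≡1 = <⇒≢ (≤-<-trans 0<m m<a) (trans (sym w≡1) w≡a)
  misses-1 (inj₂ w≡m+1) w≡1 = <⇒≢ 0<m (suc-injective (trans (sym w≡1) w≡m+1))

-- If m ≥ a+3 then a+1, a+2, a+3 are J-fixed points of [1,n], which cannot all lie on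
-- the single orbit of p.
small-a-not-good : ∀ a b c → 3 + a ≤ b + c → ¬ Good a b c
small-a-not-good a b c 3+a≤m good =
  distinct (fixed-points-coincide (proj₁ y-reached) (proj₁ z-reached) x-in x-fixed y-fixed z-fixed
                                  (proj₂ y-reached) (proj₂ z-reached))
  where
  open Evaluation a b c
  n : ℕ
  n = a + b + c
  open Reversal p J (InRange n)
         (λ (1≤i , i≤n) → perm-range a b c _ 1≤i i≤n)
         (λ (1≤i , i≤n) → reverses a b c _ 1≤i i≤n (≤-trans (m≤n+m a 3) 3+a≤m))
  x y z : ℕ
  x = 1 + a
  y = 2 + a
  z = 3 + a
  a<z : a < z
  a<z = ≤-trans (n≤1+n x) (n≤1+n y)
  y≤m : y ≤ b + c
  y≤m = ≤-trans (n≤1+n y) 3+a≤m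
  x≤m : x ≤ b + c
  x≤m = ≤-trans (n≤1+n x) y≤m
  x-in : InRange n x
  x-in = s≤s z≤n , ≤-trans x≤m (b+c≤a+b+c a b c)
  x-fixed : J x ≡ x
  x-fixed = J-middle x ≤-refl x≤m
  y-fixed : J y ≡ y
  y-fixed = J-middle y (n≤1+n x) y≤m
  z-fixed : J z ≡ z
  z-fixed = J-middle z a<z 3+a≤m
  reach : ∀ w → a < w → w ≤ b + c → ∃[ j ] iter p j x ≡ w
  reach w a<w w≤m = good x w (proj₁ x-in) (proj₂ x-in)
                      (≤-trans (s≤s z≤n) a<w) (≤-trans w≤m (b+c≤a+b+c a b c))
  y-reached : ∃[ j ] iter p j x ≡ y
  y-reached = reach y (n≤1+n x) y≤m
  z-reached : ∃[ j ] iter p j x ≡ z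
  z-reached = reach z a<z 3+a≤m
  distinct : y ≡ z ⊎ y ≡ x ⊎ z ≡ x → ⊥
  distinct (inj₁ y≡z)        = 1+n≢n (sym y≡z)
  distinct (inj₂ (inj₁ y≡x)) = 1+n≢n y≡x
  distinct (inj₂ (inj₂ z≡x)) = <⇒≢ (n≤1+n y) (sym z≡x)

HalfCondition : ℕ → ℕ → Set
HalfCondition a n = (n % 2 ≡ 0 → a ≡ n / 2 ⊎ a ≡ n / 2 ∸ 1) × (n % 2 ≡ 1 → a ≡ (n ∸ 1) / 2)

halfCondition : ∀ a t → t ≤ 2 → HalfCondition a (t + a * 2)
halfCondition a 0 _ =
  (λ _ → inj₁ (sym (m*n/n≡m a 2))) ,
  (λ odd → ⊥-elim (0≢1+n (trans (sym (m*n%n≡0 a 2)) odd)))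
halfCondition a 1 _ =
  (λ even → ⊥-elim (1+n≢0 (trans (sym ([m+kn]%n≡m%n 1 a 2)) even))) ,
  (λ _ → sym (m*n/n≡m a 2))
halfCondition a 2 _ =
  (λ _ → inj₂ (sym (cong (_∸ 1) (m*n/n≡m (suc a) 2)))) ,
  (λ odd → ⊥-elim (0≢1+n (trans (sym (m*n%n≡0 (suc a) 2)) odd)))
halfCondition a (suc (suc (suc t))) (s≤s (s≤s ()))

total-from-excess : ∀ a b c t → a + t ≡ b + c → t + a * 2 ≡ a + b + c
total-from-excess a b c t a+t≡m = begin
  t + a * 2      ≡⟨ solve (a ∷ t ∷ []) ⟩
  a + (a + t)    ≡⟨ cong (a +_) a+t≡m ⟩
  a + (b + c)    ≡⟨ +-assoc a b c ⟨
  a + b + c      ∎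

-- Lemma 8: for a good triple, a ≤ m < a + 3, so n = 2a + t with t ≤ 2.
lemma8 : (a b c : ℕ) → 0 < a → 0 < b → 0 < c → b ≤ c → Good a b c →
    ((a + b + c) % 2 ≡ 0 → (a ≡ (a + b + c) / 2 ⊎ a ≡ (a + b + c) / 2 ∸ 1))
    × ((a + b + c) % 2 ≡ 1 → a ≡ ((a + b + c) ∸ 1) / 2)
lemma8 a b c _ 0<b _ _ good =
  subst (HalfCondition a) (total-from-excess a b c t a+t≡m) (halfCondition a t t≤2)
  where
  a≤m : a ≤ b + c
  a≤m = ≮⇒≥ (λ m<a → large-a-not-good a b c 0<b m<a good)
  m<3+a : b + c < 3 + a
  m<3+a = ≰⇒> (λ 3+a≤m → small-a-not-good a b c 3+a≤m good)
  t : ℕ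
  t = proj₁ (m≤n⇒∃[o]m+o≡n a≤m)
  a+t≡m : a + t ≡ b + c
  a+t≡m = proj₂ (m≤n⇒∃[o]m+o≡n a≤m)
  t≤2 : t ≤ 2
  t≤2 = ≤-pred (+-cancelˡ-< a t 3 (subst₂ _<_ (sym a+t≡m) (+-comm 3 a) m<3+a))
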